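{- Let $A$ be a non-empty set of atoms. The six axioms of $\mathrm{EqSSCL}$, namely (Neg) $\mathsf F=\neg\mathsf T$, (Or) $x\lor_s y=\neg(\neg x\land_s\neg y)$, (Tand) $\mathsf T\land_s x=x$, (Abs) $x\land_s(x\lor_s y)=x$, (Mem) $(x\lor_s y)\land_s z=(\neg x\land_s(y\land_s z))\lor_s(x\land_s z)$, (Comm) $x\land_s y=y\land_s x$, are independent: none of them is derivable in equational logic from the other five.
   Context: Terms are over $\Sigma_{SCL}(A)=\{\land_s,\lor_s,\neg,\mathsf T,\mathsf F\}\cup A$ (atoms and $\mathsf T,\mathsf F$ constants, $\neg$ unary, $\land_s,\lor_s$ binary sequential conjunction/disjunction) with variables. -}

module Defs where

open import Data.Nat using (ℕ)
open import Data.Product using (_×_; _,_)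
open import Relation.Binary.PropositionalEquality using (_≡_)

data Term (A : Set) : Set where
  var  : ℕ → Term A
  atom : A → Term A
  T F  : Term A
  ¬ₛ   : Term A → Term A
  _∧ₛ_ : Term A → Term A → Term A
  _∨ₛ_ : Term A → Term A → Term A

infixr 6 _∧ₛ_
infixr 5 _∨ₛ_

_[_] : {A : Set} → Term A → (ℕ → Term A) → Term A
var n    [ σ ] = σ n
atom a   [ σ ] = atom a
T        [ σ ] = T
F        [ σ ] = F
¬ₛ t     [ σ ] = ¬ₛ (t [ σ ])
(t ∧ₛ u) [ σ ] = (t [ σ ]) ∧ₛ (u [ σ ])
(t ∨ₛ u) [ σ ] = (t [ σ ]) ∨ₛ (u [ σ ])

data Ax : Set where
  Neg Or Tand Abs Mem Comm : Ax

Equation : Set → Set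
Equation A = Term A × Term A

module _ {A : Set} where
  x y z : Term A
  x = var 0
  y = var 1
  z = var 2

  axiom : Ax → Equation A
  axiom Neg  = F , ¬ₛ T
  axiom Or   = x ∨ₛ y , ¬ₛ (¬ₛ x ∧ₛ ¬ₛ y)
  axiom Tand = T ∧ₛ x , x
  axiom Abs  = x ∧ₛ (x ∨ₛ y) , x
  axiom Mem  = (x ∨ₛ y) ∧ₛ z , (¬ₛ x ∧ₛ (y ∧ₛ z)) ∨ₛ (x ∧ₛ z)
  axiom Comm = x ∧ₛ y , y ∧ₛ x

data _⊢_≈_ {A : Set} (E : Ax → Set) : Term A → Term A → Set where
  ax    : ∀ {l r} (j : Ax) → E j → axiom j ≡ (l , r) → E ⊢ l ≈ r
  refl  : ∀ {t} → E ⊢ t ≈ t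
  sym   : ∀ {t u} → E ⊢ t ≈ u → E ⊢ u ≈ t
  trans : ∀ {t u v} → E ⊢ t ≈ u → E ⊢ u ≈ v → E ⊢ t ≈ v
  subst : ∀ {t u} (σ : ℕ → Term A) → E ⊢ t ≈ u → E ⊢ (t [ σ ]) ≈ (u [ σ ])
  cong¬ : ∀ {t u} → E ⊢ t ≈ u → E ⊢ ¬ₛ t ≈ ¬ₛ u
  cong∧ : ∀ {t t' u u'} → E ⊢ t ≈ t' → E ⊢ u ≈ u' → E ⊢ (t ∧ₛ u) ≈ (t' ∧ₛ u')
  cong∨ : ∀ {t t' u u'} → E ⊢ t ≈ t' → E ⊢ u ≈ u' → E ⊢ (t ∨ₛ u) ≈ (t' ∨ₛ u')

module Submission where

-- Evaluation of terms commutes with substitution,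
-- so equational derivations are sound: if a model satisfies every axiom used
-- in a derivation, it satisfies the derived equation.  Hence an axiom i is not
-- derivable from the others as soon as some model satisfies the other five
-- axioms but violates i (`independent`).
--
-- It therefore suffices to give six countermodels, one per axiom.  All but one
-- live on the Booleans: Boolean algebra with a wrong truth value (for Neg and
-- Tand), its order dual with a trivial negation (Or), and degenerate variants
-- with a constant disjunction (Abs) or with exclusive or as conjunction (Mem).
-- The countermodel for Comm is McCarthy's three-valued left-sequential logic,
-- where an undefined left operand propagates but an undefined right one may be
-- short-circuited away.

open import Defs
open import Data.Bool using (Bool; true; false; not; _∧_; _∨_; _xor_)
open import Data.Bool.Properties
  using (∧-comm; ∨-comm; ∧-abs-∨; ∨-abs-∧; ∨-distribʳ-∧; ∨-identityʳ; xor-comm; xor-identityʳ; not-involutive)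
open import Data.Nat using (ℕ; zero; suc)
open import Data.Product using (proj₁; proj₂; _,_)
open import Function using (const)
open import Relation.Binary.PropositionalEquality as ≡ using (_≡_; _≢_; refl)
open import Relation.Nullary using (¬_; contradiction)

record Model : Set₁ where
  field
    Carrier     : Set
    ⊤ᴹ ⊥ᴹ       : Carrier
    ¬ᴹ          : Carrier → Carrier
    _∧ᴹ_ _∨ᴹ_   : Carrier → Carrier → Carrier

Law : Model → Ax → Set
Law m = law
  where
  open Model m
  law : Ax → Set
  law Neg  = ⊥ᴹ ≡ ¬ᴹ ⊤ᴹ
  law Or   = ∀ p q → p ∨ᴹ q ≡ ¬ᴹ (¬ᴹ p ∧ᴹ ¬ᴹ q)
  law Tand = ∀ p → ⊤ᴹ ∧ᴹ p ≡ p
  law Abs  = ∀ p q → p ∧ᴹ (p ∨ᴹ q) ≡ p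
  law Mem  = ∀ p q r → (p ∨ᴹ q) ∧ᴹ r ≡ (¬ᴹ p ∧ᴹ (q ∧ᴹ r)) ∨ᴹ (p ∧ᴹ r)
  law Comm = ∀ p q → p ∧ᴹ q ≡ q ∧ᴹ p

module Semantics (m : Model) {A : Set} (α : A → Model.Carrier m) where
  open Model m

  ⟦_⟧ : Term A → (ℕ → Carrier) → Carrier
  ⟦ var k ⟧  ρ = ρ k
  ⟦ atom a ⟧ ρ = α a
  ⟦ T ⟧      ρ = ⊤ᴹ
  ⟦ F ⟧      ρ = ⊥ᴹ
  ⟦ ¬ₛ t ⟧   ρ = ¬ᴹ (⟦ t ⟧ ρ)
  ⟦ t ∧ₛ u ⟧ ρ = ⟦ t ⟧ ρ ∧ᴹ ⟦ u ⟧ ρ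
  ⟦ t ∨ₛ u ⟧ ρ = ⟦ t ⟧ ρ ∨ᴹ ⟦ u ⟧ ρ

  Valid : Equation A → Set
  Valid (l , r) = ∀ ρ → ⟦ l ⟧ ρ ≡ ⟦ r ⟧ ρ

  ⟦⟧-[] : ∀ t σ ρ → ⟦ t [ σ ] ⟧ ρ ≡ ⟦ t ⟧ (λ k → ⟦ σ k ⟧ ρ)
  ⟦⟧-[] (var k)  σ ρ = refl
  ⟦⟧-[] (atom a) σ ρ = refl
  ⟦⟧-[] T        σ ρ = refl
  ⟦⟧-[] F        σ ρ = refl
  ⟦⟧-[] (¬ₛ t)   σ ρ = ≡.cong ¬ᴹ (⟦⟧-[] t σ ρ)
  ⟦⟧-[] (t ∧ₛ u) σ ρ = ≡.cong₂ _∧ᴹ_ (⟦⟧-[] t σ ρ) (⟦⟧-[] u σ ρ)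
  ⟦⟧-[] (t ∨ₛ u) σ ρ = ≡.cong₂ _∨ᴹ_ (⟦⟧-[] t σ ρ) (⟦⟧-[] u σ ρ)

  ρ₃ : Carrier → Carrier → Carrier → ℕ → Carrier
  ρ₃ p q r zero          = p
  ρ₃ p q r (suc zero)    = q
  ρ₃ p q r (suc (suc _)) = r

  law⇒valid : ∀ j → Law m j → Valid (axiom j)
  law⇒valid Neg  h ρ = h
  law⇒valid Or   h ρ = h (ρ 0) (ρ 1)
  law⇒valid Tand h ρ = h (ρ 0)
  law⇒valid Abs  h ρ = h (ρ 0) (ρ 1)
  law⇒valid Mem  h ρ = h (ρ 0) (ρ 1) (ρ 2)
  law⇒valid Comm h ρ = h (ρ 0) (ρ 1)

  valid⇒law : ∀ j → Valid (axiom j) → Law m j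
  valid⇒law Neg  v       = v (const ⊤ᴹ)
  valid⇒law Or   v p q   = v (ρ₃ p q q)
  valid⇒law Tand v p     = v (ρ₃ p p p)
  valid⇒law Abs  v p q   = v (ρ₃ p q q)
  valid⇒law Mem  v p q r = v (ρ₃ p q r)
  valid⇒law Comm v p q   = v (ρ₃ p q q)

  sound : ∀ {E : Ax → Set} → (∀ j → E j → Law m j) →
          ∀ {l r} → E ⊢ l ≈ r → Valid (l , r)
  sound h (ax j e eq)           = ≡.subst Valid eq (law⇒valid j (h j e))
  sound h refl                ρ = refl
  sound h (sym d)             ρ = ≡.sym (sound h d ρ)
  sound h (trans d d')        ρ = ≡.trans (sound h d ρ) (sound h d' ρ)
  sound h (subst {t} {u} σ d) ρ = begin
    ⟦ t [ σ ] ⟧ ρ                ≡⟨ ⟦⟧-[] t σ ρ ⟩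
    ⟦ t ⟧ (λ k → ⟦ σ k ⟧ ρ)      ≡⟨ sound h d _ ⟩
    ⟦ u ⟧ (λ k → ⟦ σ k ⟧ ρ)      ≡⟨ ⟦⟧-[] u σ ρ ⟨
    ⟦ u [ σ ] ⟧ ρ                ∎
    where open ≡.≡-Reasoning
  sound h (cong¬ d)           ρ = ≡.cong ¬ᴹ (sound h d ρ)
  sound h (cong∧ d d')        ρ = ≡.cong₂ _∧ᴹ_ (sound h d ρ) (sound h d' ρ)
  sound h (cong∨ d d')        ρ = ≡.cong₂ _∨ᴹ_ (sound h d ρ) (sound h d' ρ)

independent : {A : Set} (m : Model) (i : Ax) →
  (∀ j → j ≢ i → Law m j) → ¬ Law m i →
  ¬ ((λ j → j ≢ i) ⊢ proj₁ (axiom {A} i) ≈ proj₂ (axiom {A} i))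
independent m i laws violated d = violated (valid⇒law i (sound laws d))
  where open Semantics m (const (Model.⊤ᴹ m))

boolean : Bool → Bool → Model
boolean t f = record
  { Carrier = Bool ; ⊤ᴹ = t ; ⊥ᴹ = f ; ¬ᴹ = not ; _∧ᴹ_ = _∧_ ; _∨ᴹ_ = _∨_ }

boolean-or : ∀ t f → Law (boolean t f) Or
boolean-or t f true  q = refl
boolean-or t f false q = ≡.sym (not-involutive q)

boolean-abs : ∀ t f → Law (boolean t f) Abs
boolean-abs t f = ∧-abs-∨

boolean-mem : ∀ t f → Law (boolean t f) Mem
boolean-mem t f true  q r = refl
boolean-mem t f false q r = ≡.sym (∨-identityʳ (q ∧ r))

boolean-comm : ∀ t f → Law (boolean t f) Comm
boolean-comm t f = ∧-comm

neg-model : Model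
neg-model = boolean true true

neg-laws : ∀ j → j ≢ Neg → Law neg-model j
neg-laws Neg  Neg≢Neg = contradiction refl Neg≢Neg
neg-laws Or   _       = boolean-or true true
neg-laws Tand _       = λ p → refl
neg-laws Abs  _       = boolean-abs true true
neg-laws Mem  _       = boolean-mem true true
neg-laws Comm _       = boolean-comm true true

neg-violated : ¬ Law neg-model Neg
neg-violated ()

-- Countermodel for Tand: T and F are swapped, so T ∧s x is always false.
tand-model : Model
tand-model = boolean false true

tand-laws : ∀ j → j ≢ Tand → Law tand-model j
tand-laws Neg  _         = refl
tand-laws Or   _         = boolean-or false true
tand-laws Tand Tand≢Tand = contradiction refl Tand≢Tand
tand-laws Abs  _         = boolean-abs false true
tand-laws Mem  _         = boolean-mem false true
tand-laws Comm _         = boolean-comm false true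

tand-violated : ¬ Law tand-model Tand
tand-violated h with h true
... | ()

-- Countermodel for Or: the order dual of Boolean algebra (∧s read as ∨ and
-- ∨s as ∧) with constant negation and constants, so ¬(¬x ∧s ¬y) is trivial.
or-model : Model
or-model = record
  { Carrier = Bool ; ⊤ᴹ = false ; ⊥ᴹ = false ; ¬ᴹ = const false
  ; _∧ᴹ_ = _∨_ ; _∨ᴹ_ = _∧_ }

or-laws : ∀ j → j ≢ Or → Law or-model j
or-laws Neg  _     = refl
or-laws Or   Or≢Or = contradiction refl Or≢Or
or-laws Tand _     = λ p → refl
or-laws Abs  _     = ∨-abs-∧
or-laws Mem  _     = λ p q r → ≡.trans (∨-distribʳ-∧ r p q) (∧-comm (p ∨ r) (q ∨ r))
or-laws Comm _     = ∨-comm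

or-violated : ¬ Law or-model Or
or-violated h with h true true
... | ()

-- Countermodel for Abs: ∨s is constantly false, so x ∧s (x ∨s y) is false.
abs-model : Model
abs-model = record
  { Carrier = Bool ; ⊤ᴹ = true ; ⊥ᴹ = false ; ¬ᴹ = const false
  ; _∧ᴹ_ = _∧_ ; _∨ᴹ_ = λ _ _ → false }

abs-laws : ∀ j → j ≢ Abs → Law abs-model j
abs-laws Neg  _       = refl
abs-laws Or   _       = λ p q → refl
abs-laws Tand _       = λ p → refl
abs-laws Abs  Abs≢Abs = contradiction refl Abs≢Abs
abs-laws Mem  _       = λ p q r → refl
abs-laws Comm _       = ∧-comm

abs-violated : ¬ Law abs-model Abs
abs-violated h with h true true
... | ()

-- Countermodel for Mem: ∧s is exclusive or and everything else is constantly
-- false, so the left side of Mem is z while the right side is false.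
mem-model : Model
mem-model = record
  { Carrier = Bool ; ⊤ᴹ = false ; ⊥ᴹ = false ; ¬ᴹ = const false
  ; _∧ᴹ_ = _xor_ ; _∨ᴹ_ = λ _ _ → false }

mem-laws : ∀ j → j ≢ Mem → Law mem-model j
mem-laws Neg  _       = refl
mem-laws Or   _       = λ p q → refl
mem-laws Tand _       = λ p → refl
mem-laws Abs  _       = λ p q → xor-identityʳ p
mem-laws Mem  Mem≢Mem = contradiction refl Mem≢Mem
mem-laws Comm _       = xor-comm

mem-violated : ¬ Law mem-model Mem
mem-violated h with h true true true
... | ()

-- McCarthy's three-valued left-sequential logic: the left operand of ∧s and
-- ∨s is evaluated first, and if it is undefined the result is undefined.
data Three : Set where
  true₃ false₃ undef₃ : Three

¬₃ : Three → Three
¬₃ true₃  = false₃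
¬₃ false₃ = true₃
¬₃ undef₃ = undef₃

_∧₃_ : Three → Three → Three
true₃  ∧₃ q = q
false₃ ∧₃ _ = false₃
undef₃ ∧₃ _ = undef₃

_∨₃_ : Three → Three → Three
true₃  ∨₃ _ = true₃
false₃ ∨₃ q = q
undef₃ ∨₃ _ = undef₃

¬₃-involutive : ∀ p → ¬₃ (¬₃ p) ≡ p
¬₃-involutive true₃  = refl
¬₃-involutive false₃ = refl
¬₃-involutive undef₃ = refl

∨₃-identityʳ : ∀ p → p ∨₃ false₃ ≡ p
∨₃-identityʳ true₃  = refl
∨₃-identityʳ false₃ = refl
∨₃-identityʳ undef₃ = refl

-- Countermodel for Comm: false ∧s undefined is false, but undefined ∧s false
-- is undefined.
comm-model : Model
comm-model = record
  { Carrier = Three ; ⊤ᴹ = true₃ ; ⊥ᴹ = false₃ ; ¬ᴹ = ¬₃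
  ; _∧ᴹ_ = _∧₃_ ; _∨ᴹ_ = _∨₃_ }

comm-laws : ∀ j → j ≢ Comm → Law comm-model j
comm-laws Neg  _         = refl
comm-laws Or   _         = deMorgan
  where
  deMorgan : ∀ p q → p ∨₃ q ≡ ¬₃ (¬₃ p ∧₃ ¬₃ q)
  deMorgan true₃  q = refl
  deMorgan false₃ q = ≡.sym (¬₃-involutive q)
  deMorgan undef₃ q = refl
comm-laws Tand _         = λ p → refl
comm-laws Abs  _         = absorption
  where
  absorption : ∀ p q → p ∧₃ (p ∨₃ q) ≡ p
  absorption true₃  q = refl
  absorption false₃ q = refl
  absorption undef₃ q = refl
comm-laws Mem  _         = memory
  where
  memory : ∀ p q r → (p ∨₃ q) ∧₃ r ≡ (¬₃ p ∧₃ (q ∧₃ r)) ∨₃ (p ∧₃ r)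
  memory true₃  q r = refl
  memory false₃ q r = ≡.sym (∨₃-identityʳ (q ∧₃ r))
  memory undef₃ q r = refl
comm-laws Comm Comm≢Comm = contradiction refl Comm≢Comm

comm-violated : ¬ Law comm-model Comm
comm-violated h with h undef₃ false₃
... | ()

countermodel : Ax → Model
countermodel Neg  = neg-model
countermodel Or   = or-model
countermodel Tand = tand-model
countermodel Abs  = abs-model
countermodel Mem  = mem-model
countermodel Comm = comm-model

countermodel-laws : ∀ i j → j ≢ i → Law (countermodel i) j
countermodel-laws Neg  = neg-laws
countermodel-laws Or   = or-laws
countermodel-laws Tand = tand-laws
countermodel-laws Abs  = abs-laws
countermodel-laws Mem  = mem-laws
countermodel-laws Comm = comm-laws

countermodel-violates : ∀ i → ¬ Law (countermodel i) i
countermodel-violates Neg  = neg-violated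
countermodel-violates Or   = or-violated
countermodel-violates Tand = tand-violated
countermodel-violates Abs  = abs-violated
countermodel-violates Mem  = mem-violated
countermodel-violates Comm = comm-violated

theorem6p3 : (A : Set) → A → (i : Ax) →
    ¬ ((λ j → j ≢ i) ⊢ proj₁ (axiom {A} i) ≈ proj₂ (axiom {A} i))
theorem6p3 A _ i =
  independent (countermodel i) i (countermodel-laws i) (countermodel-violates i)
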